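{- Let $k\ge2$ and let $E\subset\mathbb{N}_0$ be a $k$-automatic set. Assume that for every word $w\in\Sigma_k^*$ there is an integer $n\in E$ such that $w$ is a factor of $(n)_k$. Then for some $m\in\mathbb{N}_0$ the set $E-m=\{n-m:n\in E\}$ is an IP set.
   Context: $\Sigma_k=\{0,\dots,k-1\}$, $\Sigma_k^*$ the finite words over it, $(n)_k$ the base-$k$ expansion of $n$ without leading zeros. A word $v$ is a factor of $w$ if $w=uvu'$ for some words $u,u'$. $E$ is $k$-automatic if its characteristic sequence $a_n=1_{n\in E}$ satisfies $a_n=\tau(\delta(s_0,(n)_k))$ for some finite set $S$, $s_0\in S$, $\delta\colon S\times\Sigma_k\to S$ (extended to words by reading letters left to right), $\tau\colon S\to\{0,1\}$. For a sequence $(n_i)_{i\in\mathbb{N}}\subset\mathbb{N}$, $\mathrm{FS}(n_i)=\{\sum_{i\in\alpha}n_i:\alpha\subset\mathbb{N},\ 0<|\alpha|<\infty\}$; a set is IP if it contains $\mathrm{FS}(n_i)$ for some such sequence. -}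

module Defs where

open import Data.Nat using (ℕ; zero; suc; _+_; _*_; _<_; _≤_; NonZero)
open import Data.Nat.DivMod using (_/_; _%_; m%n<n)
open import Data.Fin using (Fin; fromℕ<)
open import Data.List using (List; []; _∷_; _++_; reverse; map)
open import Data.Nat.ListAction using (sum)
open import Data.Bool using (Bool; true)
open import Data.Product using (Σ; ∃; _×_; _,_)
open import Relation.Binary.PropositionalEquality using (_≡_)

-- least significant digit first; fuel f must be ≥ n
digitsRevFuel : (k : ℕ) → .{{_ : NonZero k}} → ℕ → ℕ → List (Fin k)
digitsRevFuel k zero n = []
digitsRevFuel k (suc f) zero = []
digitsRevFuel k (suc f) (suc n) =
  fromℕ< (m%n<n (suc n) k) ∷ digitsRevFuel k f (suc n / k)

-- (n)_k : base-k expansion, most significant digit first, no leading zeros;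
-- (0)_k is the empty word.
base : (k : ℕ) → .{{_ : NonZero k}} → ℕ → List (Fin k)
base k n = reverse (digitsRevFuel k n n)

record DFA (k : ℕ) : Set where
  field
    s  : ℕ
    s₀ : Fin s
    δ  : Fin s → Fin k → Fin s
    τ  : Fin s → Bool

run : ∀ {s k} → (Fin s → Fin k → Fin s) → Fin s → List (Fin k) → Fin s
run δ q [] = q
run δ q (a ∷ w) = run δ (δ q a) w

Accepts : ∀ {k} .{{_ : NonZero k}} → DFA k → ℕ → Set
Accepts {k} A n = DFA.τ A (run (DFA.δ A) (DFA.s₀ A) (base k n)) ≡ true

Factor : ∀ {A : Set} → List A → List A → Set
Factor {A} v w = Σ (List A) λ u → Σ (List A) λ u' → u ++ v ++ u' ≡ w

-- finite nonempty subsets of ℕ as strictly increasing nonempty lists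
data Increasing : List ℕ → Set where
  inc-one  : ∀ i → Increasing (i ∷ [])
  inc-cons : ∀ {i j l} → i < j → Increasing (j ∷ l) → Increasing (i ∷ j ∷ l)

-- FS(n_i) ⊆ P, with n_i ∈ ℕ = {1,2,...}
IP : (ℕ → Set) → Set
IP P = Σ (ℕ → ℕ) λ n →
  ((i : ℕ) → 1 ≤ n i) ×
  ((α : List ℕ) → Increasing α → P (sum (map n α)))

module Submission where

-- Fix an automaton for E with s states and an exponent a ≥ 1 making g^a idempotent for
-- every self-map g of the states (a = s!, by pigeonhole on orbits). A *block* is a word B
-- with nonzero leading digit and a state P with s₀ →B P, P →B P and P →0^(t|B|) P for all t.
-- If some y leads from P to acceptance, every word B 0^* B … 0^* B 0^(iL) y (L = |B|) is
-- accepted, so E - val(y) contains FS(n_i) for n_i = val(B)·k^(iL+|y|). A block with live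
-- P is found by descent: if w = 1w' occurs as (n)_k = u w u' with n ∈ E, then (u w 0^a)^a
-- is a block; either its P is live, or some extension w v of w strictly shrinks the set of
-- states p with p →w (live state). Liveness is decidable as a stabilising fixpoint.

open import Defs
open import Data.Nat
  using (ℕ; zero; suc; _+_; _*_; _∸_; _^_; _≤_; _<_; z≤n; s≤s; s≤s⁻¹; pred; NonZero; _!)
open import Data.Nat.Properties
open import Data.Nat.Divisibility using (_∣_; divides; ∣-trans; m≤n⇒m!∣n!)
open import Data.Nat.DivMod using (_/_; _%_; m%n<n; +-distrib-/; m<n⇒m/n≡0; m*n/n≡m; m*n%n≡0; [m+kn]%n≡m%n; m/n<m; m<n⇒m%n≡m; m≡m%n+[m/n]*n)
open import Data.Nat.GeneralisedArithmetic using (iterate)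
open import Data.Nat.ListAction using (sum)
open import Data.Nat.Tactic.RingSolver using (solve-∀)
open import Data.Fin using (Fin; toℕ; fromℕ<) renaming (zero to fzero; suc to fsuc)
open import Data.Fin.Properties using (pigeonhole; toℕ<n; fromℕ<-cong; fromℕ<-toℕ; toℕ-fromℕ<)
open import Data.Fin.Subset using (Subset; _∈_; _⊂_; ∣_∣)
open import Data.Fin.Subset.Properties using (_⊂?_; p⊂q⇒∣p∣<∣q∣; ∣p∣≤n)
open import Data.Vec.Base using (tabulate)
open import Data.Vec.Properties using (lookup∘tabulate; []=⇒lookup; lookup⇒[]=)
open import Data.Bool using (Bool; true; false; _∨_)
open import Data.List using (List; []; _∷_; _++_; length; reverse; map)
open import Data.List.Properties
  using (++-assoc; ++-identityʳ; ++-conicalʳ; length-++; length-reverse; reverse-++; reverse-involutive; unfold-reverse; ∷-injectiveˡ)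
open import Data.Product using (Σ; _×_; _,_; proj₁; proj₂)
open import Data.Sum using (_⊎_; inj₁; inj₂)
open import Function using (_∘_)
open import Relation.Nullary using (yes; no; contradiction)
open import Relation.Binary.PropositionalEquality

iterate-+ : ∀ {A : Set} (g : A → A) x m n → iterate g x (m + n) ≡ iterate g (iterate g x m) n
iterate-+ g x zero    n = refl
iterate-+ g x (suc m) n = iterate-+ g (g x) m n

iterate-fixed : ∀ {A : Set} (g : A → A) x a → iterate g x a ≡ x → ∀ m → iterate g x (m * a) ≡ x
iterate-fixed g x a fixed zero    = refl
iterate-fixed g x a fixed (suc m) = begin
  iterate g x (a + m * a)          ≡⟨ iterate-+ g x a (m * a) ⟩
  iterate g (iterate g x a) (m * a) ≡⟨ cong (λ z → iterate g z (m * a)) fixed ⟩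
  iterate g x (m * a)              ≡⟨ iterate-fixed g x a fixed m ⟩
  x                                ∎
  where open ≡-Reasoning

n≤n! : ∀ n → n ≤ n !
n≤n! zero    = z≤n
n≤n! (suc n) = m≤m*n (suc n) (n !) {{n !≢0}}

divides-factorial : ∀ {d s} → 1 ≤ d → d ≤ s → d ∣ s !
divides-factorial {suc d} _ d≤s = ∣-trans (divides (d !) (*-comm (suc d) (d !))) (m≤n⇒m!∣n! d≤s)

-- Pigeonhole on x, g x, …, g^s x: after i ≤ s steps the orbit of x enters a cycle of
-- length d with 1 ≤ d ≤ s.
orbit-cycle : ∀ {s} (g : Fin s → Fin s) x → Σ ℕ λ i → Σ ℕ λ d →
  i ≤ s × 1 ≤ d × d ≤ s × iterate g (iterate g x i) d ≡ iterate g x i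
orbit-cycle {s} g x with pigeonhole (≤-refl {suc s}) (λ t → iterate g x (toℕ t))
... | i , j , i<j , same = toℕ i , toℕ j ∸ toℕ i , ≤-trans (<⇒≤ i<j) j≤s
                         , m<n⇒0<n∸m i<j , ≤-trans (m∸n≤m (toℕ j) (toℕ i)) j≤s , cycle
  where
  open ≡-Reasoning
  j≤s : toℕ j ≤ s
  j≤s = s≤s⁻¹ (toℕ<n j)
  cycle : iterate g (iterate g x (toℕ i)) (toℕ j ∸ toℕ i) ≡ iterate g x (toℕ i)
  cycle = begin
    iterate g (iterate g x (toℕ i)) (toℕ j ∸ toℕ i) ≡⟨ iterate-+ g x (toℕ i) (toℕ j ∸ toℕ i) ⟨
    iterate g x (toℕ i + (toℕ j ∸ toℕ i))          ≡⟨ cong (iterate g x) (m+[n∸m]≡n (<⇒≤ i<j)) ⟩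
    iterate g x (toℕ j)                            ≡⟨ same ⟨
    iterate g x (toℕ i)                            ∎

-- For every self-map g of an s-element set, g^(s!) is idempotent: the preperiod is at
-- most s ≤ s! and every period d ≤ s divides s!.
idempotent-factorial : ∀ {s} (g : Fin s → Fin s) x → iterate g x (s ! + s !) ≡ iterate g x (s !)
idempotent-factorial {s} g x with orbit-cycle g x
... | i , d , i≤s , 1≤d , d≤s , cycle = begin
  iterate g x (a + a)          ≡⟨ cong (iterate g x) split ⟩
  iterate g x (i + (a + r))    ≡⟨ iterate-+ g x i (a + r) ⟩
  iterate g y (a + r)          ≡⟨ iterate-+ g y a r ⟩
  iterate g (iterate g y a) r  ≡⟨ cong (λ z → iterate g z r) y-fixed ⟩
  iterate g y r                ≡⟨ iterate-+ g x i r ⟨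
  iterate g x (i + r)          ≡⟨ cong (iterate g x) i+r≡a ⟩
  iterate g x a                ∎
  where
  open ≡-Reasoning
  a = s !
  y = iterate g x i
  r = a ∸ i
  i+r≡a : i + r ≡ a
  i+r≡a = m+[n∸m]≡n (≤-trans i≤s (n≤n! s))
  split : a + a ≡ i + (a + r)
  split = trans (cong (_+ a) (sym i+r≡a)) (trans (+-assoc i r a) (cong (i +_) (+-comm r a)))
  y-fixed : iterate g y a ≡ y
  y-fixed with divides-factorial 1≤d d≤s
  ... | divides q a≡q*d = trans (cong (iterate g y) a≡q*d) (iterate-fixed g y d cycle q)

idempotent-exponent : ∀ s → Σ ℕ λ a' →
  ∀ (g : Fin s → Fin s) x → iterate g x (suc a' + suc a') ≡ iterate g x (suc a')
idempotent-exponent s = pred (s !) , λ g x →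
  subst (λ a → iterate g x (a + a) ≡ iterate g x a) (sym (suc-pred (s !) {{s !≢0}})) (idempotent-factorial g x)

-- Boolean predicates on Fin n, read as subsets (so their sizes can be compared), and
-- pointwise implication between them.
module _ {n : ℕ} where

  ⟦_⟧ : (Fin n → Bool) → Subset n
  ⟦ f ⟧ = tabulate f

  _⊑_ : (Fin n → Bool) → (Fin n → Bool) → Set
  f ⊑ g = ∀ x → f x ≡ true → g x ≡ true

  ∈⟦⟧⁺ : ∀ {f x} → f x ≡ true → x ∈ ⟦ f ⟧
  ∈⟦⟧⁺ {f} {x} fx = lookup⇒[]= x (tabulate f) (trans (lookup∘tabulate f x) fx)

  ∈⟦⟧⁻ : ∀ {f x} → x ∈ ⟦ f ⟧ → f x ≡ true
  ∈⟦⟧⁻ {f} {x} x∈f = trans (sym (lookup∘tabulate f x)) ([]=⇒lookup x∈f)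

  ⊑⇒⊂ : ∀ {f g} → f ⊑ g → ∀ x → f x ≡ false → g x ≡ true → ⟦ f ⟧ ⊂ ⟦ g ⟧
  ⊑⇒⊂ f⊑g x fx gx = (λ y∈f → ∈⟦⟧⁺ (f⊑g _ (∈⟦⟧⁻ y∈f)))
                  , x , ∈⟦⟧⁺ gx , λ x∈f → contradiction (trans (sym (∈⟦⟧⁻ x∈f)) fx) λ ()

  -- An increasing chain of subsets of Fin n cannot grow more than n times, so at some
  -- step it stops growing.
  chain-stalls : (F : ℕ → Fin n → Bool) → (∀ t → F t ⊑ F (suc t)) → Σ ℕ λ t → F (suc t) ⊑ F t
  chain-stalls F grows with stalled-or-large (suc n)
    where
    stalled-or-large : ∀ t → (Σ ℕ λ t₀ → F (suc t₀) ⊑ F t₀) ⊎ t ≤ ∣ ⟦ F t ⟧ ∣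
    stalled-or-large zero = inj₂ z≤n
    stalled-or-large (suc t) with stalled-or-large t
    ... | inj₁ stalled = inj₁ stalled
    ... | inj₂ large with ⟦ F t ⟧ ⊂? ⟦ F (suc t) ⟧
    ...   | yes grew  = inj₂ (≤-<-trans large (p⊂q⇒∣p∣<∣q∣ grew))
    ...   | no no-growth = inj₁ (t , stalls)
      where
      stalls : F (suc t) ⊑ F t
      stalls x Fx with F t x in e
      ... | true  = refl
      ... | false = contradiction (⊑⇒⊂ (grows t) x e Fx) no-growth
  ... | inj₁ stalled = stalled
  ... | inj₂ too-large = contradiction (∣p∣≤n ⟦ F (suc n) ⟧) (<⇒≱ too-large)

anyFin : ∀ {k} → (Fin k → Bool) → Bool
anyFin {zero}  p = false
anyFin {suc k} p = p fzero ∨ anyFin (p ∘ fsuc)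

anyFin-intro : ∀ {k} (p : Fin k → Bool) a → p a ≡ true → anyFin p ≡ true
anyFin-intro p fzero    pa rewrite pa = refl
anyFin-intro p (fsuc a) pa with p fzero
... | true  = refl
... | false = anyFin-intro (p ∘ fsuc) a pa

anyFin-elim : ∀ {k} (p : Fin k → Bool) → anyFin p ≡ true → Σ (Fin k) λ a → p a ≡ true
anyFin-elim {suc k} p any with p fzero in p0
... | true  = fzero , p0
... | false with anyFin-elim (p ∘ fsuc) any
...   | a , pa = fsuc a , pa

∨-elim : ∀ b c → b ∨ c ≡ true → b ≡ true ⊎ c ≡ true
∨-elim true  c _  = inj₁ refl
∨-elim false c bc = inj₂ bc

∨-introʳ : ∀ b {c} → c ≡ true → b ∨ c ≡ true
∨-introʳ true  _ = refl
∨-introʳ false c = c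

run-++ : ∀ {s k} (δ : Fin s → Fin k → Fin s) q xs ys → run δ q (xs ++ ys) ≡ run δ (run δ q xs) ys
run-++ δ q []       ys = refl
run-++ δ q (x ∷ xs) ys = run-++ δ (δ q x) xs ys

repeat : ∀ {A : Set} → ℕ → List A → List A
repeat zero    w = []
repeat (suc n) w = w ++ repeat n w

repeat-suc : ∀ {A : Set} n (w : List A) → repeat (suc n) w ≡ repeat n w ++ w
repeat-suc zero    w = ++-identityʳ w
repeat-suc (suc n) w = trans (cong (w ++_) (repeat-suc n w)) (sym (++-assoc w (repeat n w) w))

length-repeat : ∀ {A : Set} n (w : List A) → length (repeat n w) ≡ n * length w
length-repeat zero    w = refl
length-repeat (suc n) w = trans (length-++ w) (cong (length w +_) (length-repeat n w))

run-repeat : ∀ {s k} (δ : Fin s → Fin k → Fin s) n w q →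
  run δ q (repeat n w) ≡ iterate (λ p → run δ p w) q n
run-repeat δ zero    w q = refl
run-repeat δ (suc n) w q = trans (run-++ δ q w (repeat n w)) (run-repeat δ n w (run δ q w))

run-repeat-fixed : ∀ {s k} (δ : Fin s → Fin k → Fin s) a w q →
  run δ q (repeat a w) ≡ q → ∀ m → run δ q (repeat (m * a) w) ≡ q
run-repeat-fixed δ a w q fixed m =
  trans (run-repeat δ (m * a) w q)
        (iterate-fixed (λ p → run δ p w) q a (trans (sym (run-repeat δ a w q)) fixed) m)

-- Live states of an automaton, and the decidability of liveness: the states accepting
-- some word of length ≤ t form an increasing chain, which stalls and is then constant.
module Liveness {s k : ℕ} (δ : Fin s → Fin k → Fin s) (τ : Fin s → Bool) where

  Live : Fin s → Set
  Live q = Σ (List (Fin k)) λ y → τ (run δ q y) ≡ true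

  live-prefix : ∀ q w → Live (run δ q w) → Live q
  live-prefix q w (y , accepts) = w ++ y , trans (cong τ (run-++ δ q w y)) accepts

  within : ℕ → Fin s → Bool
  within zero    q = τ q
  within (suc t) q = within t q ∨ anyFin (λ a → within t (δ q a))

  within-sound : ∀ t q → within t q ≡ true → Live q
  within-sound zero    q acc = [] , acc
  within-sound (suc t) q acc with ∨-elim (within t q) _ acc
  ... | inj₁ earlier = within-sound t q earlier
  ... | inj₂ later with anyFin-elim (λ a → within t (δ q a)) later
  ...   | a , after-a with within-sound t (δ q a) after-a
  ...     | y , accepts = a ∷ y , accepts

  within-complete : ∀ q y → τ (run δ q y) ≡ true → within (length y) q ≡ true
  within-complete q []      accepts = accepts
  within-complete q (a ∷ y) accepts = ∨-introʳ (within (length y) q)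
    (anyFin-intro (λ b → within (length y) (δ q b)) a (within-complete (δ q a) y accepts))

  within-grows : ∀ t → within t ⊑ within (suc t)
  within-grows t q acc = cong (_∨ anyFin (λ a → within t (δ q a))) acc

  within-mono : ∀ {t t'} → t ≤ t' → within t ⊑ within t'
  within-mono {t} {t'} t≤t' q acc =
    subst (λ u → within u q ≡ true) (m∸n+n≡m t≤t') (grow-by (t' ∸ t) q acc)
    where
    grow-by : ∀ r → within t ⊑ within (r + t)
    grow-by zero    q acc = acc
    grow-by (suc r) q acc = within-grows (r + t) q (grow-by r q acc)

  stall-propagates : ∀ t → within (suc t) ⊑ within t → within (suc (suc t)) ⊑ within (suc t)
  stall-propagates t stalled q acc with ∨-elim (within (suc t) q) _ acc
  ... | inj₁ earlier = earlier
  ... | inj₂ later with anyFin-elim (λ a → within (suc t) (δ q a)) later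
  ...   | a , after-a = ∨-introʳ (within t q)
    (anyFin-intro (λ b → within t (δ q b)) a (stalled (δ q a) after-a))

  stalled-forever : ∀ t → within (suc t) ⊑ within t → ∀ r → within (r + t) ⊑ within t
  stalled-forever t stalled zero    q acc = acc
  stalled-forever t stalled (suc r) q acc = stalled-forever t stalled r q (stalled-at r q acc)
    where
    stalled-at : ∀ r → within (suc (r + t)) ⊑ within (r + t)
    stalled-at zero    = stalled
    stalled-at (suc r) = stall-propagates (r + t) (stalled-at r)

  stall : Σ ℕ λ t → within (suc t) ⊑ within t
  stall = chain-stalls within within-grows

  t₀ : ℕ
  t₀ = proj₁ stall

  -- Liveness is decided by within t₀: every accepted word can be shortened to length ≤ t₀
  -- as far as the set of states accepting it is concerned.
  isLive : Fin s → Bool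
  isLive = within t₀

  isLive-sound : ∀ q → isLive q ≡ true → Live q
  isLive-sound = within-sound t₀

  isLive-complete : ∀ q → Live q → isLive q ≡ true
  isLive-complete q (y , accepts) with ≤-total (length y) t₀
  ... | inj₁ short = within-mono short q (within-complete q y accepts)
  ... | inj₂ long  = stalled-forever t₀ (proj₂ stall) (length y ∸ t₀) q
    (subst (λ u → within u q ≡ true) (sym (m∸n+n≡m long)) (within-complete q y accepts))

module Digits (k' : ℕ) where

  k : ℕ
  k = suc (suc k')

  valueLSD : List (Fin k) → ℕ
  valueLSD []       = 0
  valueLSD (d ∷ ds) = toℕ d + valueLSD ds * k

  value : List (Fin k) → ℕ
  value w = valueLSD (reverse w)

  valueLSD-++ : ∀ xs ys → valueLSD (xs ++ ys) ≡ valueLSD xs + valueLSD ys * k ^ length xs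
  valueLSD-++ []       ys = sym (*-identityʳ (valueLSD ys))
  valueLSD-++ (x ∷ xs) ys = trans (cong (λ v → toℕ x + v * k) (valueLSD-++ xs ys))
                                  (shift (toℕ x) (valueLSD xs) (valueLSD ys) (k ^ length xs) k)
    where
    shift : ∀ x a b p k → x + (a + b * p) * k ≡ (x + a * k) + b * (k * p)
    shift = solve-∀

  value-++ : ∀ xs ys → value (xs ++ ys) ≡ value xs * k ^ length ys + value ys
  value-++ xs ys = begin
    valueLSD (reverse (xs ++ ys))                ≡⟨ cong valueLSD (reverse-++ xs ys) ⟩
    valueLSD (reverse ys ++ reverse xs)          ≡⟨ valueLSD-++ (reverse ys) (reverse xs) ⟩
    value ys + value xs * k ^ length (reverse ys) ≡⟨ cong (λ l → value ys + value xs * k ^ l) (length-reverse ys) ⟩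
    value ys + value xs * k ^ length ys           ≡⟨ +-comm (value ys) _ ⟩
    value xs * k ^ length ys + value ys           ∎
    where open ≡-Reasoning

  zeros : ℕ → List (Fin k)
  zeros n = repeat n (fzero ∷ [])

  length-zeros : ∀ n → length (zeros n) ≡ n
  length-zeros n = trans (length-repeat n (fzero ∷ [])) (*-identityʳ n)

  value-zeros : ∀ n → value (zeros n) ≡ 0
  value-zeros zero    = refl
  value-zeros (suc n) = trans (value-++ (fzero ∷ []) (zeros n)) (value-zeros n)

  value-zeros-++ : ∀ n w → value (zeros n ++ w) ≡ value w
  value-zeros-++ n w = trans (value-++ (zeros n) w) (cong (λ v → v * k ^ length w + value w) (value-zeros n))

  value-++-zeros : ∀ w n → value (w ++ zeros n) ≡ value w * k ^ n
  value-++-zeros w n = trans (value-++ w (zeros n))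
    (trans (cong₂ (λ l v → value w * k ^ l + v) (length-zeros n) (value-zeros n)) (+-identityʳ _))

  -- Digit lists (least significant first) without a trailing zero: the reversals of words
  -- without leading zero.
  data Canonical : List (Fin k) → Set where
    c-nil  : Canonical []
    c-one  : ∀ {d} → toℕ d ≢ 0 → Canonical (d ∷ [])
    c-cons : ∀ d {e es} → Canonical (e ∷ es) → Canonical (d ∷ e ∷ es)

  canonical-tail : ∀ {d ds} → Canonical (d ∷ ds) → Canonical ds
  canonical-tail (c-one _)    = c-nil
  canonical-tail (c-cons _ c) = c

  canonical-positive : ∀ {ds} → Canonical ds → ds ≢ [] → 0 < valueLSD ds
  canonical-positive c-nil          ds≢[] = contradiction refl ds≢[]
  canonical-positive (c-one {d} d≢0) _       = ≤-trans (n≢0⇒n>0 d≢0) (m≤m+n (toℕ d) 0)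
  canonical-positive (c-cons d {e} {es} c) _ =
    ≤-trans (≤-trans (canonical-positive c λ ()) (m≤m*n (valueLSD (e ∷ es)) k)) (m≤n+m _ (toℕ d))

  canonical-snoc : ∀ {d} → toℕ d ≢ 0 → ∀ xs → Canonical (xs ++ d ∷ [])
  canonical-snoc d≢0 []           = c-one d≢0
  canonical-snoc d≢0 (x ∷ [])     = c-cons x (c-one d≢0)
  canonical-snoc d≢0 (x ∷ y ∷ xs) = c-cons x (canonical-snoc d≢0 (y ∷ xs))

  canonical-cons : ∀ d {ds} → Canonical ds → ds ≢ [] → Canonical (d ∷ ds)
  canonical-cons d c-nil            ds≢[] = contradiction refl ds≢[]
  canonical-cons d c@(c-one _)      _        = c-cons d c
  canonical-cons d c@(c-cons _ _)   _        = c-cons d c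

  canonical-last : ∀ {ds} → Canonical ds →
    ds ≡ [] ⊎ Σ (List (Fin k)) λ ys → Σ (Fin k) λ d → ds ≡ ys ++ d ∷ [] × toℕ d ≢ 0
  canonical-last c-nil       = inj₁ refl
  canonical-last (c-one d≢0) = inj₂ ([] , _ , refl , d≢0)
  canonical-last (c-cons x c) with canonical-last c
  ... | inj₂ (ys , d , ds≡ , d≢0) = inj₂ (x ∷ ys , d , cong (x ∷_) ds≡ , d≢0)

  digit-div : ∀ (d : Fin k) v → (toℕ d + v * k) / k ≡ v
  digit-div d v = begin
    (toℕ d + v * k) / k      ≡⟨ +-distrib-/ (toℕ d) (v * k) no-carry ⟩
    toℕ d / k + v * k / k    ≡⟨ cong₂ _+_ (m<n⇒m/n≡0 (toℕ<n d)) (m*n/n≡m v k) ⟩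
    v                        ∎
    where
    open ≡-Reasoning
    no-carry : toℕ d % k + (v * k) % k < k
    no-carry = subst (_< k) (sym (trans (cong₂ _+_ (m<n⇒m%n≡m (toℕ<n d)) (m*n%n≡0 v k)) (+-identityʳ (toℕ d))))
                     (toℕ<n d)

  digit-mod : ∀ (d : Fin k) v → (toℕ d + v * k) % k ≡ toℕ d
  digit-mod d v = trans ([m+kn]%n≡m%n (toℕ d) v k) (m<n⇒m%n≡m (toℕ<n d))

  digitsRev-0 : ∀ f → digitsRevFuel k f 0 ≡ []
  digitsRev-0 zero    = refl
  digitsRev-0 (suc f) = refl

  digitsRev-nonempty : ∀ f q → suc q ≤ f → digitsRevFuel k f (suc q) ≢ []
  digitsRev-nonempty (suc f) q _ ()

  digitsRev-value : ∀ {ds} → Canonical ds → ∀ f n → n ≡ valueLSD ds → n ≤ f → digitsRevFuel k f n ≡ ds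
  digitsRev-value c-nil f n n≡0 _ rewrite n≡0 = digitsRev-0 f
  digitsRev-value {d ∷ ds} c f zero n≡ _ =
    contradiction (sym n≡) (>⇒≢ (canonical-positive c λ ()))
  digitsRev-value {d ∷ ds} c (suc f) (suc n) n≡ n≤f =
    cong₂ _∷_ first-digit (digitsRev-value (canonical-tail c) f (suc n / k) rest-value rest-fuel)
    where
    first-digit : fromℕ< (m%n<n (suc n) k) ≡ d
    first-digit = trans (fromℕ<-cong _ _ (trans (cong (_% k) n≡) (digit-mod d (valueLSD ds))) (m%n<n (suc n) k) (toℕ<n d))
                        (fromℕ<-toℕ d (toℕ<n d))
    rest-value : suc n / k ≡ valueLSD ds
    rest-value = trans (cong (_/ k) n≡) (digit-div d (valueLSD ds))
    rest-fuel : suc n / k ≤ f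
    rest-fuel = s≤s⁻¹ (≤-trans (m/n<m (suc n) k (s≤s (s≤s z≤n))) n≤f)

  digitsRev-canonical : ∀ f n → n ≤ f → Canonical (digitsRevFuel k f n)
  digitsRev-canonical zero    n       _   = c-nil
  digitsRev-canonical (suc f) zero    _   = c-nil
  digitsRev-canonical (suc f) (suc n) n≤f with suc n / k in quotient
  ... | zero rewrite digitsRev-0 f = c-one last-digit≢0
    where
    last-digit≢0 : toℕ (fromℕ< (m%n<n (suc n) k)) ≢ 0
    last-digit≢0 digit≡0 = 1+n≢0 (trans (m≡m%n+[m/n]*n (suc n) k)
      (cong₂ (λ r q → r + q * k) (trans (sym (toℕ-fromℕ< (m%n<n (suc n) k))) digit≡0) quotient))
  ... | suc q = canonical-cons _ (digitsRev-canonical f (suc q) q<f) (digitsRev-nonempty f q q<f)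
    where
    q<f : suc q ≤ f
    q<f = s≤s⁻¹ (≤-trans (subst (_< suc n) quotient (m/n<m (suc n) k (s≤s (s≤s z≤n)))) n≤f)

  data NonZeroLead : List (Fin k) → Set where
    lead : ∀ {d} → toℕ d ≢ 0 → ∀ ds → NonZeroLead (d ∷ ds)

  nonZeroLead-++ : ∀ {xs} → NonZeroLead xs → ∀ ys → NonZeroLead (xs ++ ys)
  nonZeroLead-++ (lead d≢0 ds) ys = lead d≢0 (ds ++ ys)

  canonical-reverse : ∀ {w} → NonZeroLead w → Canonical (reverse w)
  canonical-reverse (lead {d} d≢0 ds) = subst Canonical (sym (unfold-reverse d ds)) (canonical-snoc d≢0 (reverse ds))

  value-positive : ∀ {w} → NonZeroLead w → 0 < value w
  value-positive {d ∷ ds} nzl@(lead _ _) = canonical-positive (canonical-reverse nzl)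
    λ empty → contradiction (++-conicalʳ (reverse ds) (d ∷ []) (trans (sym (unfold-reverse d ds)) empty)) λ ()

  base-value : ∀ {w} → NonZeroLead w → base k (value w) ≡ w
  base-value {w} nzl = begin
    reverse (digitsRevFuel k (value w) (value w)) ≡⟨ cong reverse (digitsRev-value (canonical-reverse nzl) _ _ refl ≤-refl) ⟩
    reverse (reverse w)                           ≡⟨ reverse-involutive w ⟩
    w                                             ∎
    where open ≡-Reasoning

  base-leading-digit : ∀ n {x r} → base k n ≡ x ∷ r → toℕ x ≢ 0
  base-leading-digit n expansion with canonical-last (digitsRev-canonical n n ≤-refl)
  ... | inj₁ no-digits = contradiction (trans (sym (cong reverse no-digits)) expansion) λ ()
  ... | inj₂ (ys , d , digits≡ , d≢0) = subst (λ x → toℕ x ≢ 0) (∷-injectiveˡ leading) d≢0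
    where
    leading : d ∷ reverse ys ≡ _
    leading = trans (sym (trans (cong reverse digits≡) (reverse-++ ys (d ∷ [])))) expansion

  prefix-lead : ∀ {n} u {u' t} → u ++ u' ≡ base k n → NonZeroLead t → NonZeroLead (u ++ t)
  prefix-lead {n} []      _      t-lead = t-lead
  prefix-lead {n} (x ∷ u) prefix _      = lead (base-leading-digit n (sym prefix)) _

module Blocks (k' : ℕ) (A : DFA (suc (suc k'))) where
  open Digits k'
  open DFA A
  open Liveness δ τ

  record Block : Set where
    field
      word    : List (Fin k)
      leading : NonZeroLead word
      P       : Fin s
      enter   : run δ s₀ word ≡ P
      loop    : run δ P word ≡ P
      pad     : ∀ t → run δ P (zeros (t * length word)) ≡ P

  a' : ℕ
  a' = proj₁ (idempotent-exponent s)

  a : ℕ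
  a = suc a'

  power-idempotent : ∀ q Y → run δ (run δ q (repeat a Y)) (repeat a Y) ≡ run δ q (repeat a Y)
  power-idempotent q Y = begin
    run δ (run δ q (repeat a Y)) (repeat a Y) ≡⟨ run-repeat δ a Y _ ⟩
    iterate f (run δ q (repeat a Y)) a        ≡⟨ cong (λ p → iterate f p a) (run-repeat δ a Y q) ⟩
    iterate f (iterate f q a) a               ≡⟨ iterate-+ f q a a ⟨
    iterate f q (a + a)                       ≡⟨ proj₂ (idempotent-exponent s) f q ⟩
    iterate f q a                             ≡⟨ run-repeat δ a Y q ⟨
    run δ q (repeat a Y)                      ∎
    where
    open ≡-Reasoning
    f : Fin s → Fin s
    f p = run δ p Y

  -- the digit 1, which starts every word of the descent and so gives blocks a nonzero lead
  one : Fin k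
  one = fsuc fzero

  record Round (w : List (Fin k)) : Set where
    field
      block   : Block
      q       : Fin s
      v       : List (Fin k)
      w-live  : Live (run δ q w)
      reaches : run δ q (w ++ v) ≡ Block.P block

  -- Given an occurrence u w u' = (n)_k, n ∈ E, of w = 1w', the word B = (u w 0^a)^a is a
  -- block, and q = s₀·u, v = 0^a (u w 0^a)^(a-1) witness that its state lies beyond w.
  round : ∀ n w' u u' → Accepts A n → u ++ (one ∷ w') ++ u' ≡ base k n → Round (one ∷ w')
  round n w' u u' accepted occurs = record
    { block   = record { word = B ; leading = B-leading ; P = P ; enter = refl ; loop = power-idempotent s₀ Y ; pad = P-pad }
    ; q       = run δ s₀ u
    ; v       = zeros a ++ repeat a' Y
    ; w-live  = u' , w-live
    ; reaches = sym P-after-w }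
    where
    open ≡-Reasoning
    w = one ∷ w'
    Y = u ++ w ++ zeros a
    B = repeat a Y
    P = run δ s₀ B
    X = run δ s₀ (repeat a' Y ++ u ++ w)

    w-live : τ (run δ (run δ (run δ s₀ u) w) u') ≡ true
    w-live = begin
      τ (run δ (run δ (run δ s₀ u) w) u') ≡⟨ cong τ (run-++ δ (run δ s₀ u) w u') ⟨
      τ (run δ (run δ s₀ u) (w ++ u'))    ≡⟨ cong τ (run-++ δ s₀ u (w ++ u')) ⟨
      τ (run δ s₀ (u ++ w ++ u'))         ≡⟨ cong (λ z → τ (run δ s₀ z)) occurs ⟩
      τ (run δ s₀ (base k n))             ≡⟨ accepted ⟩
      true                                ∎

    B-leading : NonZeroLead B
    B-leading = nonZeroLead-++ (prefix-lead {n} u occurs (lead (λ ()) (w' ++ zeros a))) (repeat a' Y)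

    P-after-w : P ≡ run δ (run δ s₀ u) (w ++ zeros a ++ repeat a' Y)
    P-after-w = begin
      run δ s₀ ((u ++ w ++ zeros a) ++ repeat a' Y) ≡⟨ cong (run δ s₀) (++-assoc u (w ++ zeros a) (repeat a' Y)) ⟩
      run δ s₀ (u ++ (w ++ zeros a) ++ repeat a' Y) ≡⟨ cong (λ z → run δ s₀ (u ++ z)) (++-assoc w (zeros a) (repeat a' Y)) ⟩
      run δ s₀ (u ++ w ++ zeros a ++ repeat a' Y)   ≡⟨ run-++ δ s₀ u _ ⟩
      run δ (run δ s₀ u) (w ++ zeros a ++ repeat a' Y) ∎

    -- B = Y^(a-1) u w 0^a ends with 0^a, so P is a state reached after reading 0^a.
    P-after-zeros : P ≡ run δ X (zeros a)
    P-after-zeros = begin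
      run δ s₀ (repeat a Y)                            ≡⟨ cong (run δ s₀) (repeat-suc a' Y) ⟩
      run δ s₀ (repeat a' Y ++ u ++ w ++ zeros a)       ≡⟨ cong (λ z → run δ s₀ (repeat a' Y ++ z)) (++-assoc u w (zeros a)) ⟨
      run δ s₀ (repeat a' Y ++ (u ++ w) ++ zeros a)     ≡⟨ cong (run δ s₀) (++-assoc (repeat a' Y) (u ++ w) (zeros a)) ⟨
      run δ s₀ ((repeat a' Y ++ u ++ w) ++ zeros a)     ≡⟨ run-++ δ s₀ (repeat a' Y ++ u ++ w) (zeros a) ⟩
      run δ X (zeros a)                                ∎

    P-zeros : run δ P (zeros a) ≡ P
    P-zeros = begin
      run δ P (zeros a)                ≡⟨ cong (λ p → run δ p (zeros a)) P-after-zeros ⟩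
      run δ (run δ X (zeros a)) (zeros a) ≡⟨ power-idempotent X (fzero ∷ []) ⟩
      run δ X (zeros a)                ≡⟨ P-after-zeros ⟨
      P                                ∎

    P-pad : ∀ t → run δ P (zeros (t * length B)) ≡ P
    P-pad t = subst (λ m → run δ P (zeros m) ≡ P) (sym t*|B|)
                    (run-repeat-fixed δ a (fzero ∷ []) P P-zeros (t * length Y))
      where
      t*|B| : t * length B ≡ t * length Y * a
      t*|B| = trans (cong (t *_) (trans (length-repeat a Y) (*-comm a (length Y)))) (sym (*-assoc t (length Y) a))

  liveAfter : List (Fin k) → Fin s → Bool
  liveAfter w p = isLive (run δ p w)

  liveAfter-++ : ∀ w v → liveAfter (w ++ v) ⊑ liveAfter w
  liveAfter-++ w v p live = isLive-complete (run δ p w)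
    (live-prefix (run δ p w) v (subst Live (run-++ δ p w v) (isLive-sound (run δ p (w ++ v)) live)))

  Hypothesis : Set
  Hypothesis = (w : List (Fin k)) → Σ ℕ λ n → Accepts A n × Factor w (base k n)

  -- Each round either yields a block whose state is live, or replaces w by an extension
  -- w v for which the set {p : liveAfter w p} strictly shrinks; the fuel bounds its size.
  descend : Hypothesis → (fuel : ℕ) (w' : List (Fin k)) →
    ∣ ⟦ liveAfter (one ∷ w') ⟧ ∣ < fuel → Σ Block (Live ∘ Block.P)
  descend H (suc fuel) w' bound with H (one ∷ w')
  ... | n , accepted , u , u' , occurs with round n w' u u' accepted occurs
  ...   | r with isLive (Block.P (Round.block r)) in P-live
  ...     | true  = Round.block r , isLive-sound _ P-live
  ...     | false = descend H fuel (w' ++ Round.v r) (≤-trans shrinks (s≤s⁻¹ bound))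
    where
    open Round r
    shrinks : ∣ ⟦ liveAfter (one ∷ w' ++ v) ⟧ ∣ < ∣ ⟦ liveAfter (one ∷ w') ⟧ ∣
    shrinks = p⊂q⇒∣p∣<∣q∣ (⊑⇒⊂ (liveAfter-++ (one ∷ w') v) q
                (trans (cong isLive reaches) P-live) (isLive-complete _ w-live))

  live-block : Hypothesis → Σ Block (Live ∘ Block.P)
  live-block H = descend H (suc ∣ ⟦ liveAfter (one ∷ []) ⟧ ∣) [] ≤-refl

-- The IP set carried by a block with live state: the words B 0^* B … 0^* B 0^(iL) y, with
-- copies of B exactly in the block positions i ∈ α, are accepted and have value
-- Σ_{i∈α} n_i + val(y).
module Construction (k' : ℕ) (A : DFA (suc (suc k'))) (b : Blocks.Block k' A)
                    (y : List (Fin (suc (suc k')))) (accepts : DFA.τ A (run (DFA.δ A) (Blocks.Block.P b) y) ≡ true) where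
  open Digits k'
  open DFA A
  open Blocks.Block b renaming (word to B)

  L : ℕ
  L = length B

  -- For an increasing list α = i₀ < i₁ < …, the word with B in block positions i ∈ α
  -- (most significant first), zero blocks in between, and no blocks below i₀.
  blocks : List ℕ → List (Fin k)
  blocks []          = []
  blocks (i ∷ [])    = B
  blocks (i ∷ j ∷ l) = blocks (j ∷ l) ++ zeros ((j ∸ suc i) * L) ++ B

  lowest : List ℕ → ℕ
  lowest []      = 0
  lowest (i ∷ _) = i

  layout : List ℕ → List (Fin k)
  layout α = blocks α ++ zeros (lowest α * L)

  blockValue : ℕ → ℕ
  blockValue i = value B * k ^ (i * L)

  gap-length : ∀ {i j} → i < j → length (zeros ((j ∸ suc i) * L) ++ B ++ zeros (i * L)) ≡ j * L
  gap-length {i} {j} i<j = begin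
    length (zeros ((j ∸ suc i) * L) ++ B ++ zeros (i * L))
      ≡⟨ length-++ (zeros ((j ∸ suc i) * L)) ⟩
    length (zeros ((j ∸ suc i) * L)) + length (B ++ zeros (i * L))
      ≡⟨ cong₂ _+_ (length-zeros ((j ∸ suc i) * L)) (trans (length-++ B) (cong (L +_) (length-zeros (i * L)))) ⟩
    (j ∸ suc i) * L + (L + i * L)
      ≡⟨ *-distribʳ-+ L (j ∸ suc i) (suc i) ⟨
    (j ∸ suc i + suc i) * L
      ≡⟨ cong (_* L) (m∸n+n≡m i<j) ⟩
    j * L ∎
    where open ≡-Reasoning

  value-layout : ∀ α → Increasing α → value (layout α) ≡ sum (map blockValue α)
  value-layout (i ∷ [])    (inc-one i)         = trans (value-++-zeros B (i * L)) (sym (+-identityʳ _))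
  value-layout (i ∷ j ∷ l) (inc-cons i<j rest) = begin
    value ((V ++ zeros ((j ∸ suc i) * L) ++ B) ++ zeros (i * L))
      ≡⟨ cong value (trans (++-assoc V _ (zeros (i * L))) (cong (V ++_) (++-assoc (zeros ((j ∸ suc i) * L)) B (zeros (i * L))))) ⟩
    value (V ++ gap)
      ≡⟨ value-++ V gap ⟩
    value V * k ^ length gap + value gap
      ≡⟨ cong₂ (λ l g → value V * k ^ l + g) (gap-length i<j)
               (trans (value-zeros-++ ((j ∸ suc i) * L) (B ++ zeros (i * L))) (value-++-zeros B (i * L))) ⟩
    value V * k ^ (j * L) + blockValue i
      ≡⟨ cong (_+ blockValue i) (trans (sym (value-++-zeros V (j * L))) (value-layout (j ∷ l) rest)) ⟩
    sum (map blockValue (j ∷ l)) + blockValue i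
      ≡⟨ +-comm _ (blockValue i) ⟩
    sum (map blockValue (i ∷ j ∷ l)) ∎
    where
    open ≡-Reasoning
    V = blocks (j ∷ l)
    gap = zeros ((j ∸ suc i) * L) ++ B ++ zeros (i * L)

  run-blocks : ∀ α → Increasing α → run δ s₀ (blocks α) ≡ P
  run-blocks (i ∷ [])    (inc-one i)       = enter
  run-blocks (i ∷ j ∷ l) (inc-cons _ rest) = begin
    run δ s₀ (blocks (j ∷ l) ++ Z ++ B)          ≡⟨ run-++ δ s₀ (blocks (j ∷ l)) (Z ++ B) ⟩
    run δ (run δ s₀ (blocks (j ∷ l))) (Z ++ B)   ≡⟨ cong (λ p → run δ p (Z ++ B)) (run-blocks (j ∷ l) rest) ⟩
    run δ P (Z ++ B)                             ≡⟨ run-++ δ P Z B ⟩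
    run δ (run δ P Z) B                          ≡⟨ cong (λ p → run δ p B) (pad (j ∸ suc i)) ⟩
    run δ P B                                    ≡⟨ loop ⟩
    P                                            ∎
    where
    open ≡-Reasoning
    Z = zeros ((j ∸ suc i) * L)

  layout-accepted : ∀ α → Increasing α → τ (run δ s₀ (layout α ++ y)) ≡ true
  layout-accepted α inc = begin
    τ (run δ s₀ ((blocks α ++ Z) ++ y))               ≡⟨ cong τ (run-++ δ s₀ (blocks α ++ Z) y) ⟩
    τ (run δ (run δ s₀ (blocks α ++ Z)) y)            ≡⟨ cong (λ p → τ (run δ p y)) (run-++ δ s₀ (blocks α) Z) ⟩
    τ (run δ (run δ (run δ s₀ (blocks α)) Z) y)       ≡⟨ cong (λ p → τ (run δ (run δ p Z) y)) (run-blocks α inc) ⟩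
    τ (run δ (run δ P Z) y)                           ≡⟨ cong (λ p → τ (run δ p y)) (pad (lowest α)) ⟩
    τ (run δ P y)                                     ≡⟨ accepts ⟩
    true                                              ∎
    where
    open ≡-Reasoning
    Z = zeros (lowest α * L)

  blocks-leading : ∀ α → Increasing α → NonZeroLead (blocks α)
  blocks-leading (i ∷ [])    (inc-one i)       = leading
  blocks-leading (i ∷ j ∷ l) (inc-cons _ rest) = nonZeroLead-++ (blocks-leading (j ∷ l) rest) _

  generator : ℕ → ℕ
  generator i = blockValue i * k ^ length y

  generator-positive : ∀ i → 1 ≤ generator i
  generator-positive i = *-mono-≤ (*-mono-≤ (value-positive leading) (m^n>0 k (i * L))) (m^n>0 k (length y))

  sum-generators : ∀ α → Increasing α → sum (map generator α) + value y ≡ value (layout α ++ y)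
  sum-generators α inc = begin
    sum (map generator α) + value y          ≡⟨ cong (_+ value y) (sum-map-* blockValue (k ^ length y) α) ⟩
    sum (map blockValue α) * k ^ length y + value y ≡⟨ cong (λ v → v * k ^ length y + value y) (value-layout α inc) ⟨
    value (layout α) * k ^ length y + value y ≡⟨ value-++ (layout α) y ⟨
    value (layout α ++ y)                    ∎
    where
    open ≡-Reasoning
    sum-map-* : ∀ (g : ℕ → ℕ) c (α : List ℕ) → sum (map (λ i → g i * c) α) ≡ sum (map g α) * c
    sum-map-* g c []      = refl
    sum-map-* g c (i ∷ α) = trans (cong (g i * c +_) (sum-map-* g c α)) (sym (*-distribʳ-+ c (g i) (sum (map g α))))

  -- Every finite sum of generators, shifted by val(y), is accepted: its expansion is layout α ++ y.
  ip : IP (λ x → Accepts A (x + value y))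
  ip = generator , generator-positive , λ α inc → begin
    τ (run δ s₀ (base k (sum (map generator α) + value y)))
      ≡⟨ cong (λ n → τ (run δ s₀ (base k n))) (sum-generators α inc) ⟩
    τ (run δ s₀ (base k (value (layout α ++ y))))
      ≡⟨ cong (λ w → τ (run δ s₀ w)) (base-value (nonZeroLead-++ (nonZeroLead-++ (blocks-leading α inc) _) y)) ⟩
    τ (run δ s₀ (layout α ++ y))
      ≡⟨ layout-accepted α inc ⟩
    true ∎
    where open ≡-Reasoning

proposition4p6 : (k : ℕ) → .{{_ : NonZero k}} → 2 ≤ k → (A : DFA k) →
    ((w : List (Fin k)) → Σ ℕ λ n → Accepts A n × Factor w (base k n)) →
    Σ ℕ λ m → IP (λ x → Accepts A (x + m))
proposition4p6 .(suc (suc k')) (s≤s (s≤s (z≤n {k'}))) A H with Blocks.live-block k' A H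
... | block , y , accepts = Digits.value k' y , Construction.ip k' A block y accepts
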